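{- Let $\langle S,\to\rangle$ be a parallel transaction system over a finite thread set $\mathcal T$ (as in the context), let $T\subseteq\mathcal T$ and $\to_T=\bigcup_{i\in T}\to_i$. If $p\to_T^{*}q$ with $p\in\mathcal N_T$, then there exists an ots $p\to^{*}q'$ under $T$ such that $q'\cong q$.
   Context: Notation: for $X\subseteq S$, $Q\subseteq S\times S$: $X\lhd Q=Q\cap(X\times S)$, $Q\rhd X=Q\cap(S\times X)$; for $X\subseteq\mathcal T$, $\mathcal N_X=\bigcap_{i\in X}\mathcal N_i$. A transition system over $\mathcal T$ is $\langle S,\to\rangle$ with $\to=\bigcup_{i\in\mathcal T}\to_i$. A thread bisimulation is an equivalence $R$ on $S$ such that $(\sigma,\sigma')\in R$ and $\sigma\to_i\sigma_1$ imply $\sigma'\to_i\sigma_1'$ for some $\sigma_1'$ with $(\sigma_1,\sigma_1')\in R$. For $A,B\subseteq S\times S$ and equivalence $R$: $A$ right-commutes with $B$ up to $R$ iff whenever $(\sigma_1,\sigma_2)\in A,(\sigma_2,\sigma_3)\in B$ there are $\sigma_4,\sigma_3'$ with $(\sigma_1,\sigma_4)\in B,(\sigma_4,\sigma_3')\in A,(\sigma_3,\sigma_3')\in R$; $A$ left-commutes with $B$ up to $R$ iff whenever $(\sigma_1,\sigma_2)\in B,(\sigma_2,\sigma_3)\in A$ there are $\sigma_4,\sigma_3'$ with $(\sigma_1,\sigma_4)\in A,(\sigma_4,\sigma_3')\in B,(\sigma_3,\sigma_3')\in R$. Phase-annotated system: for each $i$ sets $\mathcal R_i,\mathcal L_i,\mathcal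 N_i$ and a thread bisimulation $\cong_i$ with, for all $i$, $j\ne i$: $S=\mathcal R_i\uplus\mathcal L_i\uplus\mathcal N_i$; $\to_i\cap\to_j=\emptyset$; $\to_i\subseteq\mathcal L_j^2\cup\mathcal R_j^2\cup\mathcal N_j^2$; $\cong_i\subseteq\mathcal L_j^2\cup\mathcal R_j^2\cup\mathcal N_j^2$. For $X\subseteq\mathcal T$, $\cong_X=(\bigcup_{i\in X}\cong_i)^*$, $\cong=\cong_{\mathcal T}$. Parallel transaction system: additionally for all $i$, $j\ne i$: $\mathcal L_i\lhd\to_i\rhd\mathcal R_i=\emptyset$; $\to_i\rhd\mathcal R_i$ right-commutes with $\to_j$ up to $\cong_{\{j\}}$; $\mathcal L_i\lhd\to_i$ left-commutes with $\to_j$ up to $\cong_{\{i,j\}}$; every $\sigma\in\mathcal L_i$ has some $\sigma'\in\mathcal N_i$ with $\sigma\to_i^{+}\sigma'$. A uts under $T'$ is a path $q_1\to_{\psi(1)}^{+}q_2\cdots\to_{\psi(l)}^{+}q_{l+1}$ ($l\ge0$) whose blocks are $q_k=q_{k,1}\to_{\psi(k)}\cdots\to_{\psi(k)}q_{k,x_k}=q_{k+1}$ with $\psi(k)\in T'$, $q_1\in\mathcal N_{T'}$, $q_{k,1}\in\mathcal N_{\psi(k)}$, $q_{k,2},\dots,q_{k,x_k}\in\mathcal R_{\psi(k)}$. A cts (committed transaction sequence) under $T'$ is a path $p_1\to_{\varphi(1)}^{+}p_2\cdots\to_{\varphi(k)}^{+}p_{k+1}$ ($k\ge0$) whose blocks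 are $p_m=p_{m,1}\to_{\varphi(m)}\cdots\to_{\varphi(m)}p_{m,x_m}=p_{m+1}$ with $\varphi(m)\in T'$, $p_1\in\mathcal N_{T'}$, $p_{m,1}\in\mathcal N_{\varphi(m)}$, $p_{m,2},\dots,p_{m,x_m-1}\in\mathcal R_{\varphi(m)}\cup\mathcal L_{\varphi(m)}$, $p_{m,x_m}\in\mathcal L_{\varphi(m)}\cup\mathcal N_{\varphi(m)}$. If $A$ is a cts under $T_A$ and $B$ a uts under $T_B$ and $B$ starts in the last state of $A$, the concatenation $AB$ is an ots (open transaction sequence) under $T_A\cup T_B$. -}

module Defs where

open import Data.Nat using (ℕ)
open import Level using (0ℓ)
open import Data.Fin using (Fin)
open import Data.Fin.Subset using (Subset; _∈_; _∪_)
open import Data.Product using (Σ; ∃; _×_; _,_)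
open import Data.Sum using (_⊎_)
open import Data.Empty using (⊥)
open import Relation.Nullary using (¬_)
open import Relation.Binary.PropositionalEquality using (_≡_; _≢_)
open import Relation.Binary using (Rel; IsEquivalence)
open import Relation.Unary using (Pred)
open import Relation.Binary.Construct.Closure.ReflexiveTransitive using (Star)
open import Relation.Binary.Construct.Closure.Transitive using (TransClosure)

_◁_ : {S : Set} → Pred S 0ℓ → Rel S 0ℓ → Rel S 0ℓ
(X ◁ Q) a b = X a × Q a b

_▷_ : {S : Set} → Rel S 0ℓ → Pred S 0ℓ → Rel S 0ℓ
(Q ▷ X) a b = Q a b × X b

IsThreadBisim : {n : ℕ} {S : Set} → (Fin n → Rel S 0ℓ) → Rel S 0ℓ → Set
IsThreadBisim {n} {S} step R =
  IsEquivalence R ×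
  (∀ {σ σ' σ₁ : S} (i : Fin n) → R σ σ' → step i σ σ₁ →
     ∃ λ σ₁' → step i σ' σ₁' × R σ₁ σ₁')

RightCommutes : {S : Set} → Rel S 0ℓ → Rel S 0ℓ → Rel S 0ℓ → Set
RightCommutes {S} A B R =
  ∀ {σ₁ σ₂ σ₃ : S} → A σ₁ σ₂ → B σ₂ σ₃ →
  ∃ λ σ₄ → ∃ λ σ₃' → B σ₁ σ₄ × A σ₄ σ₃' × R σ₃ σ₃'

LeftCommutes : {S : Set} → Rel S 0ℓ → Rel S 0ℓ → Rel S 0ℓ → Set
LeftCommutes {S} A B R =
  ∀ {σ₁ σ₂ σ₃ : S} → B σ₁ σ₂ → A σ₂ σ₃ →
  ∃ λ σ₄ → ∃ λ σ₃' → A σ₁ σ₄ × B σ₄ σ₃' × R σ₃ σ₃'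

SamePhase : {S : Set} → Pred S 0ℓ → Pred S 0ℓ → Pred S 0ℓ → Rel S 0ℓ → Set
SamePhase {S} R L N Q =
  ∀ {a b : S} → Q a b →
  (L a × L b) ⊎ (R a × R b) ⊎ (N a × N b)

record PhaseAnnotated (n : ℕ) (S : Set) : Set₁ where
  field
    step   : Fin n → Rel S 0ℓ
    ℛ ℒ 𝒩  : Fin n → Pred S 0ℓ
    ≅ᵢ     : Fin n → Rel S 0ℓ
    ≅ᵢ-bisim : ∀ i → IsThreadBisim step (≅ᵢ i)
    cover  : ∀ i σ → ℛ i σ ⊎ ℒ i σ ⊎ 𝒩 i σ
    disjRL : ∀ i σ → ℛ i σ → ℒ i σ → ⊥
    disjRN : ∀ i σ → ℛ i σ → 𝒩 i σ → ⊥
    disjLN : ∀ i σ → ℒ i σ → 𝒩 i σ → ⊥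
    step-disj : ∀ i j → i ≢ j → ∀ {a b} → step i a b → step j a b → ⊥
    step-phase : ∀ i j → i ≢ j → SamePhase (ℛ j) (ℒ j) (𝒩 j) (step i)
    ≅-phase : ∀ i j → i ≢ j → SamePhase (ℛ j) (ℒ j) (𝒩 j) (≅ᵢ i)

  ≅[_] : Subset n → Rel S 0ℓ
  ≅[ X ] = Star (λ a b → ∃ λ i → i ∈ X × ≅ᵢ i a b)

  _≅_ : Rel S 0ℓ
  _≅_ = Star (λ a b → ∃ λ i → ≅ᵢ i a b)

  𝒩[_] : Subset n → Pred S 0ℓ
  𝒩[ X ] σ = ∀ i → i ∈ X → 𝒩 i σ

  step[_] : Subset n → Rel S 0ℓ
  step[ X ] a b = ∃ λ i → i ∈ X × step i a b

  UBlock : Fin n → Rel S 0ℓ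
  UBlock i a b = 𝒩 i a × TransClosure (step i ▷ ℛ i) a b

  UTS : Subset n → Rel S 0ℓ
  UTS T' q₁ q = 𝒩[ T' ] q₁ × Star (λ a b → ∃ λ i → i ∈ T' × UBlock i a b) q₁ q

  CBlock : Fin n → Rel S 0ℓ
  CBlock i a b =
    𝒩 i a ×
    (∃ λ c → Star (step i ▷ (λ y → ℛ i y ⊎ ℒ i y)) a c × step i c b) ×
    (ℒ i b ⊎ 𝒩 i b)

  CTS : Subset n → Rel S 0ℓ
  CTS T' p₁ p = 𝒩[ T' ] p₁ × Star (λ a b → ∃ λ i → i ∈ T' × CBlock i a b) p₁ p

  OTS : Subset n → Rel S 0ℓ
  OTS T p q = ∃ λ T_A → ∃ λ T_B → (T_A ∪ T_B ≡ T) ×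
              ∃ λ m → CTS T_A p m × UTS T_B m q

record ParallelTransactionSystem (n : ℕ) (S : Set) : Set₁ where
  field
    pa : PhaseAnnotated n S
  open PhaseAnnotated pa
  field
    no-L→R : ∀ i {a b} → ℒ i a → step i a b → ℛ i b → ⊥
    right-comm : ∀ i j → i ≢ j →
      RightCommutes (step i ▷ ℛ i) (step j) (≅[ Data.Fin.Subset.⁅ j ⁆ ])
    left-comm : ∀ i j → i ≢ j →
      LeftCommutes (ℒ i ◁ step i) (step j)
        (≅[ Data.Fin.Subset.⁅ i ⁆ ∪ Data.Fin.Subset.⁅ j ⁆ ])
    L-progress : ∀ i σ → ℒ i σ → ∃ λ σ' → 𝒩 i σ' × TransClosure (step i) σ σ'

-- The steps of the execution are processed from left to right while maintaining, up to ≅, an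
-- ots C U (committed blocks C followed by uncommitted blocks U) and the raw rest of the
-- execution. A step of thread i is commuted left past the uncommitted blocks of the other
-- threads (right commutativity of ℛ-steps), so that it joins the uncommitted work of thread i in
-- one run directly after C. As long as this run ends in ℒᵢ, the next step of thread i is pulled
-- forward through the raw rest by left commutativity; this must happen on the raw steps, since
-- ≅_{i,j} need not preserve the phases of thread j and so cannot be pushed through blocks of j.
-- Finally the run is cut into committed blocks, appended to C, and at most one uncommitted block,
-- prepended to U. Every round consumes a step of the raw rest.
module Submission where

open import Defs
open import Level using (0ℓ)
open import Function using (_∘_; id)
open import Data.Nat using (ℕ; suc; _+_; _≤_; _<_; s≤s)
open import Data.Nat.Properties using (≤-refl; ≤-trans; n≤1+n; n<1+n; +-monoʳ-≤; +-monoʳ-<)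
open import Data.Nat.Induction using (Acc; acc; <-wellFounded)
open import Data.Fin using (Fin)
open import Data.Fin.Properties using (_≟_)
open import Data.Fin.Subset using (Subset; _∈_; _∪_; _∩_; ⁅_⁆; _⊆_) renaming (⊥ to ∅)
open import Data.Fin.Subset.Properties
  using (x∈⁅x⁆; x∈⁅y⁆⇒x≡y; x∈p∪q⁻; x∈p∪q⁺; x∈p∩q⁺; p∩q⊆q; ∉⊥; ∪-abs-∩)
open import Data.Product using (∃; _×_; _,_; proj₁; proj₂)
open import Data.Sum using (_⊎_; inj₁; inj₂)
open import Data.Empty using (⊥-elim)
open import Relation.Nullary using (¬_; Dec; yes; no)
open import Relation.Binary.PropositionalEquality using (_≡_; _≢_; refl; ≢-sym)
open import Relation.Binary using (Rel; _⇒_; Reflexive; Transitive; IsEquivalence)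
open import Relation.Binary.Construct.Closure.ReflexiveTransitive as Star
  using (Star; ε; _◅_; _◅◅_)
open import Relation.Binary.Construct.Closure.Transitive using (TransClosure; [_]; _∷_)
open import Relation.Binary.Construct.Closure.Reflexive using (ReflClosure; [_]; refl)

module _ {S : Set} where

  Simulation : Rel S 0ℓ → Rel S 0ℓ → Set
  Simulation A R = ∀ {a a' b} → R a a' → A a b → ∃ λ b' → A a' b' × R b b'

  module _ {A R : Rel S 0ℓ} (sim : Simulation A R) where

    simulation-star : Simulation (Star A) R
    simulation-star r ε = _ , ε , r
    simulation-star r (x ◅ xs) =
      let (_ , y , r₁) = sim r x
          (c , ys , r₂) = simulation-star r₁ xs
      in c , y ◅ ys , r₂

    simulation-plus : Simulation (TransClosure A) R
    simulation-plus r [ x ] = let (b , y , r₁) = sim r x in b , [ y ] , r₁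
    simulation-plus r (x ∷ xs) =
      let (_ , y , r₁) = sim r x
          (c , ys , r₂) = simulation-plus r₁ xs
      in c , y ∷ ys , r₂

    star-simulation : Simulation A (Star R)
    star-simulation ε x = _ , x , ε
    star-simulation (r ◅ rs) x =
      let (_ , y , r₁) = sim r x
          (c , z , r₂) = star-simulation rs y
      in c , z , r₁ ◅ r₂

  module _ {A B R : Rel S 0ℓ} (comm : RightCommutes A B R) where

    right-commutes-plusˡ : Simulation A R → Transitive R → RightCommutes (TransClosure A) B R
    right-commutes-plusˡ sim trans [ x ] y =
      let (d , c , y' , x' , r) = comm x y in d , c , y' , [ x' ] , r
    right-commutes-plusˡ sim trans (x ∷ xs) y =
      let (_ , _ , y₁ , xs₁ , r₁) = right-commutes-plusˡ sim trans xs y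
          (d , _ , y' , x' , r₂) = comm x y₁
          (c , xs' , r₃) = simulation-plus sim r₂ xs₁
      in d , c , y' , x' ∷ xs' , trans r₁ r₃

    right-commutes-starˡ : Simulation A R → Reflexive R → Transitive R →
                           RightCommutes (Star A) B R
    right-commutes-starˡ sim rfl trans ε y = _ , _ , y , ε , rfl
    right-commutes-starˡ sim rfl trans (x ◅ xs) y =
      let (_ , _ , y₁ , xs₁ , r₁) = right-commutes-starˡ sim rfl trans xs y
          (d , _ , y' , x' , r₂) = comm x y₁
          (c , xs' , r₃) = simulation-star sim r₂ xs₁
      in d , c , y' , x' ◅ xs' , trans r₁ r₃

    right-commutes-starʳ : Simulation B R → Reflexive R → Transitive R →
                           RightCommutes A (Star B) R
    right-commutes-starʳ sim rfl trans x ys = go x rfl ys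
      where
      -- The run may start anywhere R-related to the end of x, which keeps the recursion structural.
      go : ∀ {a b b₀ c} → A a b → R b₀ b → Star B b₀ c →
           ∃ λ d → ∃ λ c' → Star B a d × A d c' × R c c'
      go x r ε = _ , _ , ε , x , r
      go x r (y ◅ ys) =
        let (_ , y₁ , r₁) = sim r y
            (_ , _ , y' , x' , r₂) = comm x y₁
            (d , c' , ys' , x'' , r₃) = go x' (trans r₁ r₂) ys
        in d , c' , y' ◅ ys' , x'' , r₃

module PhaseAnnotatedProperties {n : ℕ} {S : Set} (pa : PhaseAnnotated n S) where
  open PhaseAnnotated pa

  SamePhaseOf : Fin n → Rel S 0ℓ
  SamePhaseOf k a b = (ℒ k a × ℒ k b) ⊎ (ℛ k a × ℛ k b) ⊎ (𝒩 k a × 𝒩 k b)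

  module _ {k : Fin n} where

    samePhase-ℛ : ∀ {a b} → SamePhaseOf k a b → ℛ k a → ℛ k b
    samePhase-ℛ (inj₁ (La , _)) Ra = ⊥-elim (disjRL k _ Ra La)
    samePhase-ℛ (inj₂ (inj₁ (_ , Rb))) _ = Rb
    samePhase-ℛ (inj₂ (inj₂ (Na , _))) Ra = ⊥-elim (disjRN k _ Ra Na)

    samePhase-ℒ : ∀ {a b} → SamePhaseOf k a b → ℒ k a → ℒ k b
    samePhase-ℒ (inj₁ (_ , Lb)) _ = Lb
    samePhase-ℒ (inj₂ (inj₁ (Ra , _))) La = ⊥-elim (disjRL k _ Ra La)
    samePhase-ℒ (inj₂ (inj₂ (Na , _))) La = ⊥-elim (disjLN k _ La Na)

    samePhase-𝒩 : ∀ {a b} → SamePhaseOf k a b → 𝒩 k a → 𝒩 k b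
    samePhase-𝒩 (inj₁ (La , _)) Na = ⊥-elim (disjLN k _ La Na)
    samePhase-𝒩 (inj₂ (inj₁ (Ra , _))) Na = ⊥-elim (disjRN k _ Ra Na)
    samePhase-𝒩 (inj₂ (inj₂ (_ , Nb))) _ = Nb

    samePhase-refl : Reflexive (SamePhaseOf k)
    samePhase-refl {a} with cover k a
    ... | inj₁ Ra = inj₂ (inj₁ (Ra , Ra))
    ... | inj₂ (inj₁ La) = inj₁ (La , La)
    ... | inj₂ (inj₂ Na) = inj₂ (inj₂ (Na , Na))

    samePhase-sym : ∀ {a b} → SamePhaseOf k a b → SamePhaseOf k b a
    samePhase-sym (inj₁ (La , Lb)) = inj₁ (Lb , La)
    samePhase-sym (inj₂ (inj₁ (Ra , Rb))) = inj₂ (inj₁ (Rb , Ra))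
    samePhase-sym (inj₂ (inj₂ (Na , Nb))) = inj₂ (inj₂ (Nb , Na))

    samePhase-trans : Transitive (SamePhaseOf k)
    samePhase-trans (inj₁ (La , Lb)) q = inj₁ (La , samePhase-ℒ q Lb)
    samePhase-trans (inj₂ (inj₁ (Ra , Rb))) q = inj₂ (inj₁ (Ra , samePhase-ℛ q Rb))
    samePhase-trans (inj₂ (inj₂ (Na , Nb))) q = inj₂ (inj₂ (Na , samePhase-𝒩 q Nb))

    samePhase-star : ∀ {R : Rel S 0ℓ} → R ⇒ SamePhaseOf k → Star R ⇒ SamePhaseOf k
    samePhase-star f = Star.fold (SamePhaseOf k) (samePhase-trans ∘ f) samePhase-refl

    samePhase-plus : ∀ {R : Rel S 0ℓ} → R ⇒ SamePhaseOf k → TransClosure R ⇒ SamePhaseOf k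
    samePhase-plus f [ r ] = f r
    samePhase-plus f (r ∷ rs) = samePhase-trans (f r) (samePhase-plus f rs)

  ℒ? : ∀ i a → Dec (ℒ i a)
  ℒ? i a with cover i a
  ... | inj₁ Ra = no (disjRL i a Ra)
  ... | inj₂ (inj₁ La) = yes La
  ... | inj₂ (inj₂ Na) = no (λ La → disjLN i a La Na)

  ¬ℛ¬ℒ⇒𝒩 : ∀ {i a} → ¬ ℛ i a → ¬ ℒ i a → 𝒩 i a
  ¬ℛ¬ℒ⇒𝒩 {i} {a} ¬Ra ¬La with cover i a
  ... | inj₁ Ra = ⊥-elim (¬Ra Ra)
  ... | inj₂ (inj₁ La) = ⊥-elim (¬La La)
  ... | inj₂ (inj₂ Na) = Na

  ≅[]-simulation : ∀ {X} j → Simulation (step j) ≅[ X ]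
  ≅[]-simulation j = star-simulation λ (i , i∈ , r) s →
    let (b , s' , r') = proj₂ (≅ᵢ-bisim i) j r s in b , s' , (i , i∈ , r')

  ≅-simulation : ∀ j → Simulation (step j) _≅_
  ≅-simulation j = star-simulation λ (i , r) s →
    let (b , s' , r') = proj₂ (≅ᵢ-bisim i) j r s in b , s' , (i , r')

  ≅[]⇒≅ : ∀ {X} → ≅[ X ] ⇒ _≅_
  ≅[]⇒≅ = Star.map λ (i , _ , r) → i , r

  ≅-sym : ∀ {a b} → a ≅ b → b ≅ a
  ≅-sym = Star.reverse λ (i , r) → i , IsEquivalence.sym (proj₁ (≅ᵢ-bisim i)) r

  ≅⁅⁆-samePhase : ∀ {i k} → k ≢ i → ≅[ ⁅ i ⁆ ] ⇒ SamePhaseOf k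
  ≅⁅⁆-samePhase {i} {k} k≢i = samePhase-star single
    where
    single : ∀ {a b} → (∃ λ j → j ∈ ⁅ i ⁆ × ≅ᵢ j a b) → SamePhaseOf k a b
    single (j , j∈ , r) with x∈⁅y⁆⇒x≡y i j∈
    ... | refl = ≅-phase i k (≢-sym k≢i) r

  _∖_ : (Fin n → Set) → Fin n → Fin n → Set
  (Q ∖ i) k = Q k × k ≢ i

  -- Indexed by the length, which is the termination measure and is invariant under transport.
  data Path (Q : Fin n → Set) : ℕ → Rel S 0ℓ where
    []  : ∀ {a} → Path Q 0 a a
    _∷_ : ∀ {len a b c} → (∃ λ j → Q j × step j a b) → Path Q len b c → Path Q (suc len) a c

  module _ {Q : Fin n → Set} where

    Path-map : ∀ {Q' : Fin n → Set} → (∀ {j} → Q j → Q' j) → ∀ {len} → Path Q len ⇒ Path Q' len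
    Path-map f [] = []
    Path-map f ((j , qj , s) ∷ X) = (j , f qj , s) ∷ Path-map f X

    _++_ : ∀ {k l a b c} → Path Q k a b → Path Q l b c → Path Q (k + l) a c
    [] ++ Y = Y
    (x ∷ X) ++ Y = x ∷ (X ++ Y)

    path-simulation : ∀ {len} → Simulation (Path Q len) _≅_
    path-simulation r [] = _ , [] , r
    path-simulation r ((j , qj , s) ∷ X) =
      let (_ , s' , r₁) = ≅-simulation j r s
          (c , X' , r₂) = path-simulation r₁ X
      in c , (j , qj , s') ∷ X' , r₂

    find-first : ∀ i {len a b} → Path Q len a b →
                 Path (Q ∖ i) len a b ⊎
                 ∃ λ k → ∃ λ l → len ≡ k + suc l × ∃ λ y → ∃ λ z →
                   Path (Q ∖ i) k a y × step i y z × Path Q l z b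
    find-first i [] = inj₁ []
    find-first i ((j , qj , s) ∷ X) with j ≟ i | find-first i X
    ... | yes refl | _ = inj₂ (0 , _ , refl , _ , _ , [] , s , X)
    ... | no j≢i | inj₁ X' = inj₁ ((j , (qj , j≢i) , s) ∷ X')
    ... | no j≢i | inj₂ (k , l , refl , y , z , X₁ , s' , X₂) =
      inj₂ (suc k , l , refl , y , z , (j , (qj , j≢i) , s) ∷ X₁ , s' , X₂)

  AnyUBlock AnyCBlock : (Fin n → Set) → Rel S 0ℓ
  AnyUBlock Q a b = ∃ λ k → Q k × UBlock k a b
  AnyCBlock Q a b = ∃ λ k → Q k × CBlock k a b

  Uncommitted Committed : (Fin n → Set) → Rel S 0ℓ
  Uncommitted Q = Star (AnyUBlock Q)
  Committed Q = Star (AnyCBlock Q)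

  ublock-run : ∀ {i a b} → UBlock i a b → Star (step i) a b
  ublock-run (_ , run) = go run
    where
    go : ∀ {i a b} → TransClosure (step i ▷ ℛ i) a b → Star (step i) a b
    go [ (s , _) ] = s ◅ ε
    go ((s , _) ∷ ss) = s ◅ go ss

  ublock-end : ∀ {i a b} → UBlock i a b → ℛ i b
  ublock-end (_ , run) = go run
    where
    go : ∀ {i a b} → TransClosure (step i ▷ ℛ i) a b → ℛ i b
    go [ (_ , Rb) ] = Rb
    go (_ ∷ ss) = go ss

  ublock-samePhase : ∀ {k i a b} → k ≢ i → UBlock k a b → SamePhaseOf i a b
  ublock-samePhase {k} {i} k≢i (_ , run) = samePhase-plus (step-phase k i k≢i ∘ proj₁) run

  others-samePhase : ∀ {Q i} → Uncommitted (Q ∖ i) ⇒ SamePhaseOf i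
  others-samePhase = samePhase-star λ (_ , (_ , k≢i) , blk) → ublock-samePhase k≢i blk

  cblock-samePhase : ∀ {i k a b} → i ≢ k → CBlock i a b → SamePhaseOf k a b
  cblock-samePhase {i} {k} i≢k (_ , (_ , pre , s) , _) =
    samePhase-trans (samePhase-star (step-phase i k i≢k ∘ proj₁) pre) (step-phase i k i≢k s)

  cblock-¬ℛ : ∀ {j k a b} → ¬ ℛ k a → CBlock j a b → ¬ ℛ k b
  cblock-¬ℛ {j} {k} ¬Ra blk with j ≟ k | blk
  ... | yes refl | (_ , _ , inj₁ Lb) = λ Rb → disjRL k _ Rb Lb
  ... | yes refl | (_ , _ , inj₂ Nb) = λ Rb → disjRN k _ Rb Nb
  ... | no j≢k | _ = ¬Ra ∘ samePhase-ℛ (samePhase-sym (cblock-samePhase j≢k blk))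

  committed-¬ℛ : ∀ {Q k a b} → ¬ ℛ k a → Committed Q a b → ¬ ℛ k b
  committed-¬ℛ ¬Ra ε = ¬Ra
  committed-¬ℛ ¬Ra ((_ , _ , blk) ◅ C) = committed-¬ℛ (cblock-¬ℛ ¬Ra blk) C

  threads : ∀ {Q a b} → Uncommitted Q a b → Subset n
  threads ε = ∅
  threads ((k , _) ◅ U) = ⁅ k ⁆ ∪ threads U

  threads-𝒩 : ∀ {Q a b} (U : Uncommitted Q a b) → 𝒩[ threads U ] a
  threads-𝒩 ε k k∈ = ⊥-elim (∉⊥ k∈)
  threads-𝒩 ((j , _ , blk) ◅ U) k k∈ with k ≟ j | x∈p∪q⁻ ⁅ j ⁆ (threads U) k∈
  ... | yes refl | _ = proj₁ blk
  ... | no k≢j | inj₁ k∈⁅j⁆ = ⊥-elim (k≢j (x∈⁅y⁆⇒x≡y j k∈⁅j⁆))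
  ... | no k≢j | inj₂ k∈U =
    samePhase-𝒩 (samePhase-sym (ublock-samePhase (≢-sym k≢j) blk)) (threads-𝒩 U k k∈U)

  restrict : ∀ {T X a b} (U : Uncommitted (_∈ T) a b) → threads U ⊆ X →
             Uncommitted (_∈ T ∩ X) a b
  restrict ε _ = ε
  restrict ((k , k∈T , blk) ◅ U) U⊆X =
    (k , x∈p∩q⁺ (k∈T , U⊆X (x∈p∪q⁺ (inj₁ (x∈⁅x⁆ k)))) , blk) ◅ restrict U (U⊆X ∘ x∈p∪q⁺ ∘ inj₂)

  uncommitted-uts : ∀ {T a b} (U : Uncommitted (_∈ T) a b) → UTS (T ∩ threads U) a b
  uncommitted-uts {T} U = (λ k k∈ → threads-𝒩 U k (p∩q⊆q T (threads U) k∈)) , restrict U id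

  all-others : ∀ {Q i a b} → ℛ i a → Uncommitted Q a b → Uncommitted (Q ∖ i) a b
  all-others Ra ε = ε
  all-others {i = i} Ra ((k , qk , blk) ◅ U) with k ≟ i
  ... | yes refl = ⊥-elim (disjRN i _ Ra (proj₁ blk))
  ... | no k≢i =
    (k , (qk , k≢i) , blk) ◅ all-others (samePhase-ℛ (ublock-samePhase k≢i blk) Ra) U

  isolate-thread : ∀ {Q} i {a b} → Uncommitted Q a b →
                   ∃ λ s → ∃ λ e →
                     Uncommitted (Q ∖ i) a s × Star (step i) s e × Uncommitted (Q ∖ i) e b
  isolate-thread i ε = _ , _ , ε , ε , ε
  isolate-thread i ((k , qk , blk) ◅ U) with k ≟ i
  ... | yes refl = _ , _ , ε , ublock-run blk , all-others (ublock-end blk) U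
  ... | no k≢i =
    let (s , e , U₁ , B , U₂) = isolate-thread i U
    in s , e , (k , (qk , k≢i) , blk) ◅ U₁ , B , U₂

module ParallelTransactionSystemProperties {n : ℕ} {S : Set}
                                           (P : ParallelTransactionSystem n S) where
  open ParallelTransactionSystem P
  open PhaseAnnotated pa
  open PhaseAnnotatedProperties pa

  ℛ⊎ℒ : Fin n → S → Set
  ℛ⊎ℒ i a = ℛ i a ⊎ ℒ i a

  ℒ-stays : ∀ {i a c} → ℒ i a → Star (step i ▷ ℛ⊎ℒ i) a c → ℒ i c
  ℒ-stays La ε = La
  ℒ-stays {i} La ((s , inj₁ Rb) ◅ _) = ⊥-elim (no-L→R i La s Rb)
  ℒ-stays La ((_ , inj₂ Lb) ◅ ss) = ℒ-stays Lb ss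

  ℛ-end⇒ℛ⁺ : ∀ {i a c b} → Star (step i ▷ ℛ⊎ℒ i) a c → step i c b → ℛ i b →
             TransClosure (step i ▷ ℛ i) a b
  ℛ-end⇒ℛ⁺ ε s Rb = [ s , Rb ]
  ℛ-end⇒ℛ⁺ ((s₁ , inj₁ R) ◅ ss) s Rb = (s₁ , R) ∷ ℛ-end⇒ℛ⁺ ss s Rb
  ℛ-end⇒ℛ⁺ {i} ((_ , inj₂ L) ◅ ss) s Rb = ⊥-elim (no-L→R i (ℒ-stays L ss) s Rb)

  RunSplit : Fin n → Rel S 0ℓ
  RunSplit i a b = ∃ λ m → Star (CBlock i) a m × ReflClosure (UBlock i) m b

  split-open : ∀ {i a₀ c a b} → 𝒩 i a₀ → Star (step i ▷ ℛ⊎ℒ i) a₀ c → step i c a →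
               Star (step i) a b → RunSplit i a₀ b
  split-open {i} {a = a} Na₀ pre s ε with cover i a
  ... | inj₁ Ra = _ , ε , [ Na₀ , ℛ-end⇒ℛ⁺ pre s Ra ]
  ... | inj₂ (inj₁ La) = _ , (Na₀ , (_ , pre , s) , inj₁ La) ◅ ε , refl
  ... | inj₂ (inj₂ Na) = _ , (Na₀ , (_ , pre , s) , inj₂ Na) ◅ ε , refl
  split-open {i} {a = a} Na₀ pre s (s' ◅ ss) with cover i a
  ... | inj₁ Ra = split-open Na₀ (pre ◅◅ (s , inj₁ Ra) ◅ ε) s' ss
  ... | inj₂ (inj₁ La) = split-open Na₀ (pre ◅◅ (s , inj₂ La) ◅ ε) s' ss
  ... | inj₂ (inj₂ Na) =
    let (m , Cs , u) = split-open Na ε s' ss in m , (Na₀ , (_ , pre , s) , inj₂ Na) ◅ Cs , u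

  split-run : ∀ {i a b} → 𝒩 i a → Star (step i) a b → RunSplit i a b
  split-run Na ε = _ , ε , refl
  split-run Na (s ◅ ss) = split-open Na ε s ss

  ublock?-ℒ : ∀ {i a b} → ReflClosure (UBlock i) a b → ℒ i a → ℒ i b
  ublock?-ℒ refl La = La
  ublock?-ℒ {i} [ (Na , _) ] La = ⊥-elim (disjLN i _ La Na)

  ℛ-step-simulation : ∀ {i k} → k ≢ i → Simulation (step k ▷ ℛ k) ≅[ ⁅ i ⁆ ]
  ℛ-step-simulation {k = k} k≢i r (s , Rb) =
    let (b' , s' , r') = ≅[]-simulation k r s
    in b' , (s' , samePhase-ℛ (≅⁅⁆-samePhase k≢i r') Rb) , r'

  ublock-simulation : ∀ {i k} → k ≢ i → Simulation (UBlock k) ≅[ ⁅ i ⁆ ]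
  ublock-simulation k≢i r (Na , run) =
    let (b' , run' , r') = simulation-plus (ℛ-step-simulation k≢i) r run
    in b' , (samePhase-𝒩 (≅⁅⁆-samePhase k≢i r) Na , run') , r'

  other-simulation : ∀ {Q i} → Simulation (AnyUBlock (Q ∖ i)) ≅[ ⁅ i ⁆ ]
  other-simulation r (k , qk , blk) =
    let (b' , blk' , r') = ublock-simulation (proj₂ qk) r blk in b' , (k , qk , blk') , r'

  ublock-right-commutes : ∀ {i k} → k ≢ i → RightCommutes (UBlock k) (step i) ≅[ ⁅ i ⁆ ]
  ublock-right-commutes {i} {k} k≢i (Na , run) s =
    let (d , c' , s' , run' , r) =
          right-commutes-plusˡ (right-comm k i k≢i) (ℛ-step-simulation k≢i) _◅◅_ run s
    in d , c' , s' , (samePhase-𝒩 (step-phase i k (≢-sym k≢i) s') Na , run') , r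

  other-right-commutes : ∀ {Q i} → RightCommutes (AnyUBlock (Q ∖ i)) (step i) ≅[ ⁅ i ⁆ ]
  other-right-commutes (k , qk , blk) s =
    let (d , c' , s' , blk' , r) = ublock-right-commutes (proj₂ qk) blk s
    in d , c' , s' , (k , qk , blk') , r

  others-right-commute : ∀ {Q i} → RightCommutes (Uncommitted (Q ∖ i)) (step i) ≅[ ⁅ i ⁆ ]
  others-right-commute = right-commutes-starˡ other-right-commutes other-simulation ε _◅◅_

  run-right-commutes : ∀ {Q i} → RightCommutes (Uncommitted (Q ∖ i)) (Star (step i)) ≅[ ⁅ i ⁆ ]
  run-right-commutes = right-commutes-starʳ others-right-commute (≅[]-simulation _) ε _◅◅_

  ℒ-step-past-path : ∀ {Q i len a y z} → ℒ i a → Path (Q ∖ i) len a y → step i y z →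
                     ∃ λ w → ∃ λ z' → step i a w × Path (Q ∖ i) len w z' × z ≅ z'
  ℒ-step-past-path La [] s = _ , _ , s , [] , ε
  ℒ-step-past-path {i = i} La ((j , (qj , j≢i) , t) ∷ X) s =
    let Lb = samePhase-ℒ (step-phase j i j≢i t) La
        (_ , _ , s₁ , X₁ , r₁) = ℒ-step-past-path Lb X s
        (w , _ , (_ , s') , t' , r₂) = left-comm i j (≢-sym j≢i) t (Lb , s₁)
        (z' , X' , r₃) = path-simulation (≅[]⇒≅ r₂) X₁
    in w , z' , s' , (j , (qj , j≢i) , t') ∷ X' , r₁ ◅◅ r₃

  gather-run : ∀ {Q i a q c} → Uncommitted Q a q → step i q c →
               ∃ λ b → ∃ λ q' → Star (step i) a b × Uncommitted (Q ∖ i) b q' × ≅[ ⁅ i ⁆ ] c q'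
  gather-run {i = i} U s =
    let (_ , _ , U₁ , B , U₂) = isolate-thread i U
        (_ , _ , s' , U₂' , r₁) = others-right-commute U₂ s
        (b , _ , B' , U₁' , r₂) = run-right-commutes U₁ (B ◅◅ s' ◅ ε)
        (q' , U₂'' , r₃) = simulation-star other-simulation r₂ U₂'
    in b , q' , B' , U₁' ◅◅ U₂'' , r₁ ◅◅ r₃

  Saturation : Fin n → (Fin n → Set) → (Fin n → Set) → ℕ → S → S → Set
  Saturation i Qᵤ Q len b x =
    ∃ λ b' → ∃ λ q' → ∃ λ x' → ∃ λ len' → len' ≤ len ×
      Star (step i) b b' × Uncommitted (Qᵤ ∖ i) b' q' ×
      Path (λ j → Q j × (ℒ i b' → j ≢ i)) len' q' x' × x ≅ x'

  saturate : ∀ {Qᵤ Q i len b q x} → Acc _<_ len → Uncommitted (Qᵤ ∖ i) b q → Path Q len q x →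
             Saturation i Qᵤ Q len b x
  saturate {i = i} {b = b} (acc rec) U X with ℒ? i b
  ... | no ¬Lb = _ , _ , _ , _ , ≤-refl , ε , U , Path-map (λ qj → qj , ⊥-elim ∘ ¬Lb) X , ε
  ... | yes Lb with find-first i X
  ...   | inj₁ X' = _ , _ , _ , _ , ≤-refl , ε , U , Path-map (λ (qj , j≢i) → qj , λ _ → j≢i) X' , ε
  ...   | inj₂ (k , l , refl , _ , _ , X₁ , s , X₂) =
    let (_ , _ , s' , X₁' , r₁) = ℒ-step-past-path (samePhase-ℒ (others-samePhase U) Lb) X₁ s
        (_ , X₂' , r₂) = path-simulation r₁ X₂
        (_ , _ , s'' , U' , r₃) = others-right-commute U s'
        (_ , X' , r₄) = path-simulation (≅[]⇒≅ r₃) (Path-map proj₁ X₁' ++ X₂')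
        (b' , q' , x' , len' , len'≤ , B , U'' , X'' , r₅) =
          saturate (rec (+-monoʳ-< k (n<1+n l))) U' X'
    in b' , q' , x' , len' , ≤-trans len'≤ (+-monoʳ-≤ k (n≤1+n l)) ,
       s'' ◅ B , U'' , X'' , r₂ ◅◅ r₄ ◅◅ r₅

  module Construction (T : Subset n) (p : S) (Np : 𝒩[ T ] p) where

    -- A thread left in ℒ by the committed prefix may have no unprocessed steps: they could only
    -- extend a block that is already committed.
    Pending : S → Fin n → Set
    Pending m j = j ∈ T × ¬ ℒ j m

    pending-path : ∀ {a x} → Star step[ T ] a x → ∃ λ len → Path (Pending p) len a x
    pending-path ε = 0 , []
    pending-path ((j , j∈T , s) ◅ X) =
      let (len , X') = pending-path X
      in suc len , (j , (j∈T , λ Lp → disjLN j p Lp (Np j j∈T)) , s) ∷ X'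

    commit : ∀ {i m b q} → i ∈ T → 𝒩 i m → Committed (_∈ T) p m → Star (step i) m b →
             Uncommitted ((_∈ T) ∖ i) b q →
             ∃ λ m' → Committed (_∈ T) p m' × Uncommitted (_∈ T) m' q ×
               (∀ {j} → Pending m j × (ℒ i b → j ≢ i) → Pending m' j)
    commit {i} i∈T Nm C B U with split-run Nm B
    ... | m' , Cs , u =
      m' , C ◅◅ Star.map (λ blk → i , i∈T , blk) Cs , prepend u (Star.map forget U) , still-pending
      where
      forget : ∀ {a b} → AnyUBlock ((_∈ T) ∖ i) a b → AnyUBlock (_∈ T) a b
      forget (k , (k∈T , _) , blk) = k , k∈T , blk

      prepend : ∀ {a b} → ReflClosure (UBlock i) a b → Uncommitted (_∈ T) b _ →
                Uncommitted (_∈ T) a _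
      prepend refl U' = U'
      prepend [ blk ] U' = (i , i∈T , blk) ◅ U'

      still-pending : ∀ {j} → Pending _ j × (ℒ i _ → j ≢ i) → Pending m' j
      still-pending {j} ((j∈T , ¬Lm) , done) = j∈T , ¬Lm'
        where
        ¬Lm' : ¬ ℒ j m'
        ¬Lm' Lm' with j ≟ i
        ... | yes refl = done (ublock?-ℒ u Lm') refl
        ... | no j≢i =
          ¬Lm (samePhase-ℒ (samePhase-sym (samePhase-star (cblock-samePhase (≢-sym j≢i)) Cs)) Lm')

    ots : ∀ {m q} → Committed (_∈ T) p m → Uncommitted (_∈ T) m q → OTS T p q
    ots C U = T , T ∩ threads U , ∪-abs-∩ T (threads U) , _ , (Np , C) , uncommitted-uts U

    build : ∀ {len m q x} → Acc _<_ len → Committed (_∈ T) p m → Uncommitted (_∈ T) m q →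
            Path (Pending m) len q x → ∃ λ q' → OTS T p q' × x ≅ q'
    build _ C U [] = _ , ots C U , ε
    build (acc rec) C U ((i , (i∈T , ¬Lm) , s) ∷ X) =
      let Nm = ¬ℛ¬ℒ⇒𝒩 (committed-¬ℛ (λ Rp → disjRN i p Rp (Np i i∈T)) C) ¬Lm
          (_ , _ , B , U₁ , r₁) = gather-run U s
          (_ , X₁ , r₂) = path-simulation (≅[]⇒≅ r₁) X
          (_ , _ , _ , _ , len≤ , B₂ , U₂ , X₂ , r₃) = saturate (<-wellFounded _) U₁ X₁
          (_ , C' , U' , still-pending) = commit i∈T Nm C (B ◅◅ B₂) U₂
          (q' , o , r₄) = build (rec (s≤s len≤)) C' U' (Path-map still-pending X₂)
      in q' , o , r₂ ◅◅ r₃ ◅◅ r₄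

lemma5 : {n : ℕ} {S : Set} (P : ParallelTransactionSystem n S) →
    let open PhaseAnnotated (ParallelTransactionSystem.pa P) in
    (T : Subset n) (p q : S) → 𝒩[ T ] p → Star step[ T ] p q →
    ∃ λ q' → OTS T p q' × q' ≅ q
lemma5 P T p q Np X =
  let open ParallelTransactionSystemProperties P
      open PhaseAnnotatedProperties (ParallelTransactionSystem.pa P)
      open Construction T p Np
      (_ , X') = pending-path X
      (q' , o , q≅q') = build (<-wellFounded _) ε ε X'
  in q' , o , ≅-sym q≅q'
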